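{- Let $p$ be an H-PCL formula and $a$ an atom occurring in $p$. If $p\vdash a$ is provable in PCL, then there exists $w\in\mathscr{L}(\llbracket p\rrbracket)$ in which no request action on $a$ occurs.
   Context: Contract automata: fix disjoint sets $\mathbb{R}$ (requests $a$) and $\mathbb{O}$ (offers $\overline a$), idle symbol $\Box$, $\Sigma=\mathbb{R}\cup\mathbb{O}\cup\{\Box\}$, $co$ swapping $a,\overline a$ and fixing $\Box$. $\vec a\in\Sigma^n$ is a request/offer on $\alpha$ if it is $\Box^{n_1}\alpha\Box^{n_2}$ with $\alpha\in\mathbb{R}$/$\mathbb{O}$, a match if $\Box^{n_1}\alpha\Box^{n_2}co(\alpha)\Box^{n_3}$; $\vec a\bowtie\vec b$ iff $\vec a$ is a request or offer on some $\alpha$ and $\vec b$ is respectively an offer or request on $co(\alpha)$. A CA of rank $n$ is $\langle Q,\vec q_0,A^r,A^o,T,F\rangle$, $Q=Q_1\times\cdots\times Q_n$, transition labels in $(A^r\cup A^o\cup\{\Box\})^n$ being requests, offers or matches, idle components not changing state; $\mathscr{L}$ is the set of label words of paths from $\vec q_0$ to $F$. Product of CAs of ranks $r_i$: states are concatenations, initial/final componentwise, transitions are either (i) a joint move of components $i<j$ with complementary labels, label $\Box^u\vec a_i\Box^v\vec a_j\Box^z$ padded to total rank, or (ii) a move of a single component $i$ padded by idles, allowed only if no other component has, in its current state, a transition with label complementary to $\vec a_i$. $\boxtimes$ (a-product) is the product of all rank-1 projections of the operands. H-PCL formulae: $p::=\bigwedge_{i\in I}\alpha_i$, $\alpha::=\bigwedge_{j\in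 J}a_j\mid(\bigwedge_{j\in J}a_j)\rightarrow b\mid(\bigwedge_{j\in J}a_j)\twoheadrightarrow b$, $|I|\ge2$, $|J|\ge1$, distinct $a_j$, $a_j\ne b$. Translation with $\mathcal{P}=\{q\cup\{\ast\}\mid q\subseteq J\}$: $\llbracket\bigwedge_i\alpha_i\rrbracket=\boxtimes_i\llbracket\alpha_i\rrbracket$; $\llbracket\bigwedge_j a_j\rrbracket$ has the single (initial and final) state $\{\ast\}$ and loops $(\{\ast\},\overline{a_j},\{\ast\})$; $\llbracket(\bigwedge_j a_j)\rightarrow b\rrbracket$ has states $\mathcal{P}$, initial $J\cup\{\ast\}$, final $\{\ast\}$, requests $a_j$, offer $\overline b$, transitions $(J'\cup\{j\},a_j,J')$ ($j\in J$, $j\notin J'\in\mathcal P$) and $(\{\ast\},\overline b,\{\ast\})$; $\llbracket(\bigwedge_j a_j)\twoheadrightarrow b\rrbracket$ is the same but with loops $(q,\overline b,q)$ at every $q\in\mathcal{P}$. PCL sequent calculus: the intuitionistic rules $id$ ($\Gamma,p\vdash p$), $\wedge L1,\wedge L2,\wedge R,\vee L,\vee R1,\vee R2,cut$, $\rightarrow L$ (from $\Gamma,p\rightarrow q\vdash p$ and $\Gamma,p\rightarrow q,q\vdash r$ infer $\Gamma,p\rightarrow q\vdash r$), $\rightarrow R$, $\neg L$ (from $\Gamma,\neg p\vdash p$ infer $\Gamma,\neg p\vdash r$), $\neg R$ (from $\Gamma,p\vdash\bot$ infer $\Gamma\vdash\neg p$), $\bot L$, $\top R$, $weakR$ (from $\Gamma\vdash\bot$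 infer $\Gamma\vdash p$), plus $Zero$: from $\Gamma\vdash q$ infer $\Gamma\vdash p\twoheadrightarrow q$; $Fix$: from $\Gamma,p\twoheadrightarrow q,r\vdash p$ and $\Gamma,p\twoheadrightarrow q,q\vdash r$ infer $\Gamma,p\twoheadrightarrow q\vdash r$; $PrePost$: from $\Gamma,p\twoheadrightarrow q,p'\vdash p$ and $\Gamma,p\twoheadrightarrow q,q\vdash q'$ infer $\Gamma,p\twoheadrightarrow q\vdash p'\twoheadrightarrow q'$. -}

module Defs where

open import Data.Nat using (ℕ; _≤_; _<_)
open import Data.Bool using (Bool; true; false; if_then_else_)
open import Data.Unit using (⊤; tt)
open import Data.Empty using (⊥)
open import Data.Fin using (Fin; zero; toℕ; _≟_)
open import Data.Fin.Subset using (Subset; ⁅_⁆; _∪_) renaming (⊥ to ∅; _∉_ to _∉ₛ_)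
open import Data.List using (List; []; _∷_; length; lookup; concatMap)
open import Data.List.Membership.Propositional using (_∈_; _∉_)
open import Data.List.Relation.Unary.All using (All)
open import Data.List.Relation.Unary.Unique.Propositional using (Unique)
open import Data.Vec using (Vec; _∷_; []; tabulate) renaming (lookup to vlookup)
open import Data.Product using (Σ; _×_; _,_; ∃; ∃-syntax)
open import Data.Sum using (_⊎_)
open import Relation.Nullary using (¬_; does)
open import Relation.Binary.PropositionalEquality using (_≡_; _≢_)

Atom : Set
Atom = ℕ

infixr 6 _∧_
infixr 5 _∨_
infixr 4 _⇒_ _↠_

data Formula : Set where
  atom : Atom → Formula
  ⊤ᶠ ⊥ᶠ : Formula
  _∧_ _∨_ _⇒_ _↠_ : Formula → Formula → Formula
  ¬ᶠ : Formula → Formula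

⋀ : List Formula → Formula
⋀ [] = ⊤ᶠ
⋀ (x ∷ []) = x
⋀ (x ∷ y ∷ xs) = x ∧ ⋀ (y ∷ xs)

-- Contexts are lists read as sets: a formula
-- written "Γ, p" on the left of a conclusion is required to be in Γ
-- (principal formulae are retained, as in →L / Fix of the paper), and
-- hypotheses introduced in premises are consed on.

infix 2 _⊢_
data _⊢_ (Γ : List Formula) : Formula → Set where
  id     : ∀ {p} → p ∈ Γ → Γ ⊢ p
  ∧L1    : ∀ {p q r} → (p ∧ q) ∈ Γ → p ∷ Γ ⊢ r → Γ ⊢ r
  ∧L2    : ∀ {p q r} → (p ∧ q) ∈ Γ → q ∷ Γ ⊢ r → Γ ⊢ r
  ∧R     : ∀ {p q} → Γ ⊢ p → Γ ⊢ q → Γ ⊢ p ∧ q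
  ∨L     : ∀ {p q r} → (p ∨ q) ∈ Γ → p ∷ Γ ⊢ r → q ∷ Γ ⊢ r → Γ ⊢ r
  ∨R1    : ∀ {p q} → Γ ⊢ p → Γ ⊢ p ∨ q
  ∨R2    : ∀ {p q} → Γ ⊢ q → Γ ⊢ p ∨ q
  cut    : ∀ {p r} → Γ ⊢ p → p ∷ Γ ⊢ r → Γ ⊢ r
  ⇒L     : ∀ {p q r} → (p ⇒ q) ∈ Γ → Γ ⊢ p → q ∷ Γ ⊢ r → Γ ⊢ r
  ⇒R     : ∀ {p q} → p ∷ Γ ⊢ q → Γ ⊢ p ⇒ q
  ¬L     : ∀ {p r} → ¬ᶠ p ∈ Γ → Γ ⊢ p → Γ ⊢ r
  ¬R     : ∀ {p} → p ∷ Γ ⊢ ⊥ᶠ → Γ ⊢ ¬ᶠ p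
  ⊥L     : ∀ {r} → ⊥ᶠ ∈ Γ → Γ ⊢ r
  ⊤R     : Γ ⊢ ⊤ᶠ
  weakR  : ∀ {p} → Γ ⊢ ⊥ᶠ → Γ ⊢ p
  Zero   : ∀ {p q} → Γ ⊢ q → Γ ⊢ p ↠ q
  Fix    : ∀ {p q r} → (p ↠ q) ∈ Γ → r ∷ Γ ⊢ p → q ∷ Γ ⊢ r → Γ ⊢ r
  PrePost : ∀ {p q p' q'} → (p ↠ q) ∈ Γ → p' ∷ Γ ⊢ p → q ∷ Γ ⊢ q'
          → Γ ⊢ p' ↠ q'

data Clause : Set where
  conj : List Atom → Clause
  imp  : List Atom → Atom → Clause
  fuse : List Atom → Atom → Clause

WFClause : Clause → Set
WFClause (conj J)   = J ≢ [] × Unique J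
WFClause (imp J b)  = J ≢ [] × Unique J × b ∉ J
WFClause (fuse J b) = J ≢ [] × Unique J × b ∉ J

HPCL : List Clause → Set
HPCL p = 2 ≤ length p × All WFClause p

atomsF : List Atom → Formula
atomsF J = ⋀ (Data.List.map atom J)

clauseF : Clause → Formula
clauseF (conj J)   = atomsF J
clauseF (imp J b)  = atomsF J ⇒ atom b
clauseF (fuse J b) = atomsF J ↠ atom b

toFormula : List Clause → Formula
toFormula p = ⋀ (Data.List.map clauseF p)

clauseAtoms : Clause → List Atom
clauseAtoms (conj J)   = J
clauseAtoms (imp J b)  = b ∷ J
clauseAtoms (fuse J b) = b ∷ J

atoms : List Clause → List Atom
atoms = concatMap clauseAtoms

-- Σ = R ∪ O ∪ {□}:  req a = a,  off a = ā,  idle = □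
data Sym : Set where
  req off : Atom → Sym
  idle : Sym

Label : ℕ → Set
Label n = Vec Sym n

IsSingle : ∀ {n} → Sym → Label n → Set
IsSingle s v = Σ (Fin _) λ i → vlookup v i ≡ s × (∀ k → k ≢ i → vlookup v k ≡ idle)

IsRequestOn IsOfferOn : ∀ {n} → Atom → Label n → Set
IsRequestOn a v = IsSingle (req a) v
IsOfferOn a v = IsSingle (off a) v

_⋈_ : ∀ {m n} → Label m → Label n → Set
u ⋈ v = Σ Atom λ α → (IsRequestOn α u × IsOfferOn α v) ⊎ (IsOfferOn α u × IsRequestOn α v)

record CA (n : ℕ) : Set₁ where
  field
    State : Set
    init  : State
    Final : State → Set
    Trans : State → Label n → State → Set
open CA public

data Path {n} (A : CA n) : State A → List (Label n) → State A → Set where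
  []  : ∀ {s} → Path A s [] s
  _∷_ : ∀ {s l s' w s''} → Trans A s l s' → Path A s' w s'' → Path A s (l ∷ w) s''

_∈𝓛_ : ∀ {n} → List (Label n) → CA n → Set
w ∈𝓛 A = Σ (State A) λ s → Path A (init A) w s × Final A s

-- Product of rank-1 contract automata.  (Only rank-1 operands occur in
-- ⟦p⟧; a rank-1 CA is its own unique rank-1 projection, so the
-- a-product ⊠ of rank-1 CAs is their product.)

singleLabel : ∀ {n} → Fin n → Sym → Label n
singleLabel i x = tabulate λ k → if does (k ≟ i) then x else idle

matchLabel : ∀ {n} → Fin n → Sym → Fin n → Sym → Label n
matchLabel i x j y =
  tabulate λ k → if does (k ≟ i) then x else (if does (k ≟ j) then y else idle)

module _ {n : ℕ} (A : Fin n → CA 1) where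
  PState : Set
  PState = (k : Fin n) → State (A k)

  data PTrans : PState → Label n → PState → Set where
    match  : ∀ {s s'} (i j : Fin n) (x y : Sym) → toℕ i < toℕ j
           → Trans (A i) (s i) (x ∷ []) (s' i)
           → Trans (A j) (s j) (y ∷ []) (s' j)
           → (x ∷ []) ⋈ (y ∷ [])
           → (∀ k → k ≢ i → k ≢ j → s' k ≡ s k)
           → PTrans s (matchLabel i x j y) s'
    single : ∀ {s s'} (i : Fin n) (x : Sym)
           → Trans (A i) (s i) (x ∷ []) (s' i)
           → (∀ k → k ≢ i → s' k ≡ s k)
           → (∀ j → j ≢ i → ∀ y t → Trans (A j) (s j) (y ∷ []) t
                → ¬ ((x ∷ []) ⋈ (y ∷ [])))
           → PTrans s (singleLabel i x) s'

⊠ : ∀ {n} → (Fin n → CA 1) → CA n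
⊠ A = record
  { State = PState A
  ; init  = λ k → init (A k)
  ; Final = λ s → ∀ k → Final (A k) (s k)
  ; Trans = PTrans A
  }

data ConjTrans (J : List Atom) : ⊤ → Label 1 → ⊤ → Set where
  offJ : (j : Fin (length J)) → ConjTrans J tt (off (lookup J j) ∷ []) tt

-- states: q ⊆ J (standing for q ∪ {∗}); initial J, final ∅ (= {∗})
data ImpTrans (J : List Atom) (b : Atom)
     : Subset (length J) → Label 1 → Subset (length J) → Set where
  reqJ : ∀ {q'} (j : Fin (length J)) → j ∉ₛ q'
       → ImpTrans J b (q' ∪ ⁅ j ⁆) (req (lookup J j) ∷ []) q'
  offB : ImpTrans J b ∅ (off b ∷ []) ∅

data FuseTrans (J : List Atom) (b : Atom)
     : Subset (length J) → Label 1 → Subset (length J) → Set where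
  reqJ : ∀ {q'} (j : Fin (length J)) → j ∉ₛ q'
       → FuseTrans J b (q' ∪ ⁅ j ⁆) (req (lookup J j) ∷ []) q'
  offB : ∀ q → FuseTrans J b q (off b ∷ []) q

⟦_⟧c : Clause → CA 1
⟦ conj J ⟧c   = record { State = ⊤ ; init = tt ; Final = λ _ → ⊤ ; Trans = ConjTrans J }
⟦ imp J b ⟧c  = record { State = Subset (length J) ; init = Data.Fin.Subset.⊤
                       ; Final = λ q → q ≡ ∅ ; Trans = ImpTrans J b }
⟦ fuse J b ⟧c = record { State = Subset (length J) ; init = Data.Fin.Subset.⊤
                       ; Final = λ q → q ≡ ∅ ; Trans = FuseTrans J b }

⟦_⟧ : (p : List Clause) → CA (length p)
⟦ p ⟧ = ⊠ (λ k → ⟦ lookup p k ⟧c)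

-- Reading p ↠ q as q makes PCL sound for Set-valued valuations, so p ⊢ a puts a
-- into the least model of the Horn clauses of p (in which every (⋀ J) ↠ b simply
-- yields b).  By induction on membership in that model the product automaton can
-- be driven, using request moves only, to a configuration in which some component
-- offers a; afterwards every component can run its requests down to a final state.
-- A request on x is matched whenever another component currently offers x, so it
-- appears bare only if nobody offers x.  Requests on a are fired only once a is
-- offered, no component requests what it offers itself, and request moves keep
-- all offers and final components, so no bare request on a ever occurs.
module Submission where

open import Defs
open import Data.Nat as ℕ using (ℕ)
import Data.Bool as Bool
open import Data.Bool using (true; false; if_then_else_)
open import Data.Unit using (⊤; tt)
open import Data.Empty using (⊥; ⊥-elim)
open import Data.Fin using (Fin; zero; suc; _≟_)
open import Data.Fin.Properties using (any?; <-cmp)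
open import Data.Fin.Subset using (Subset; ⁅_⁆; _∪_; inside; outside)
  renaming (⊥ to ∅; ⊤ to full; _∈_ to _∈ₛ_; _∉_ to _∉ₛ_)
open import Data.Fin.Subset.Properties using (∉⊥; x∈⁅x⁆; q⊆p∪q; ∪-identityʳ)
open import Data.List using (List; _∷_; []; length; lookup; allFin; map; _++_)
open import Data.List.Properties using (tabulate-lookup)
open import Data.List.Membership.Propositional using (_∈_)
open import Data.List.Membership.Propositional.Properties using (∈-lookup; ∈-allFin)
open import Data.List.Membership.DecPropositional ℕ._≟_ using (_∈?_)
import Data.List.Relation.Unary.All as All
open import Data.List.Relation.Unary.All using (All; []; _∷_)
open import Data.List.Relation.Unary.All.Properties using (++⁺; map⁺; map⁻; tabulate⁺)
open import Data.List.Relation.Unary.Any using (index)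
open import Data.List.Relation.Unary.Any.Properties using (lookup-index)
open import Data.Vec using ([]; _∷_; there) renaming (lookup to vlookup)
open import Data.Vec.Properties using (lookup∘tabulate; ≡-dec)
open import Data.Product using (Σ; _×_; _,_; proj₁; proj₂; ∃)
open import Data.Sum using (_⊎_; inj₁; inj₂)
open import Function using (_∘_)
open import Relation.Nullary using (¬_; Dec; yes; no; does)
open import Relation.Nullary.Decidable using (_×-dec_; ¬?; dec-true; dec-false)
open import Relation.Binary using (tri<; tri≈; tri>)
open import Relation.Binary.PropositionalEquality

-- A Set-valued semantics of PCL

module Semantics (V : Atom → Set) where

  ⟪_⟫ : Formula → Set
  ⟪ atom x ⟫ = V x
  ⟪ ⊤ᶠ ⟫ = ⊤
  ⟪ ⊥ᶠ ⟫ = ⊥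
  ⟪ p ∧ q ⟫ = ⟪ p ⟫ × ⟪ q ⟫
  ⟪ p ∨ q ⟫ = ⟪ p ⟫ ⊎ ⟪ q ⟫
  ⟪ p ⇒ q ⟫ = ⟪ p ⟫ → ⟪ q ⟫
  ⟪ p ↠ q ⟫ = ⟪ q ⟫
  ⟪ ¬ᶠ p ⟫ = ⟪ p ⟫ → ⊥

  sound : ∀ {Γ p} → Γ ⊢ p → All ⟪_⟫ Γ → ⟪ p ⟫
  sound (id p∈Γ) γ = All.lookup γ p∈Γ
  sound (∧L1 p∈Γ d) γ = sound d (proj₁ (All.lookup γ p∈Γ) ∷ γ)
  sound (∧L2 p∈Γ d) γ = sound d (proj₂ (All.lookup γ p∈Γ) ∷ γ)
  sound (∧R d e) γ = sound d γ , sound e γ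
  sound (∨L p∈Γ d e) γ with All.lookup γ p∈Γ
  ... | inj₁ u = sound d (u ∷ γ)
  ... | inj₂ v = sound e (v ∷ γ)
  sound (∨R1 d) γ = inj₁ (sound d γ)
  sound (∨R2 d) γ = inj₂ (sound d γ)
  sound (cut d e) γ = sound e (sound d γ ∷ γ)
  sound (⇒L p∈Γ d e) γ = sound e (All.lookup γ p∈Γ (sound d γ) ∷ γ)
  sound (⇒R d) γ = λ u → sound d (u ∷ γ)
  sound (¬L p∈Γ d) γ = ⊥-elim (All.lookup γ p∈Γ (sound d γ))
  sound (¬R d) γ = λ u → sound d (u ∷ γ)
  sound (⊥L p∈Γ) γ = ⊥-elim (All.lookup γ p∈Γ)
  sound ⊤R γ = tt
  sound (weakR d) γ = ⊥-elim (sound d γ)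
  sound (Zero d) γ = sound d γ
  sound (Fix p∈Γ d e) γ = sound e (All.lookup γ p∈Γ ∷ γ)
  sound (PrePost p∈Γ d e) γ = sound e (All.lookup γ p∈Γ ∷ γ)

  ⋀-intro : ∀ {φs} → All ⟪_⟫ φs → ⟪ ⋀ φs ⟫
  ⋀-intro [] = tt
  ⋀-intro (u ∷ []) = u
  ⋀-intro (u ∷ us@(_ ∷ _)) = u , ⋀-intro us

  ⋀-elim : ∀ φs → ⟪ ⋀ φs ⟫ → All ⟪_⟫ φs
  ⋀-elim [] _ = []
  ⋀-elim (φ ∷ []) u = u ∷ []
  ⋀-elim (φ ∷ ψ ∷ φs) (u , us) = u ∷ ⋀-elim (ψ ∷ φs) us

_++ᴾ_ : ∀ {n} {A : CA n} {s w s' w' s''}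
      → Path A s w s' → Path A s' w' s'' → Path A s (w ++ w') s''
[] ++ᴾ π = π
(t ∷ π) ++ᴾ π' = t ∷ (π ++ᴾ π')

IsSingle-[_] : (σ : Sym) → IsSingle σ (σ ∷ [])
IsSingle-[ σ ] = zero , refl , λ { zero 0≢0 → ⊥-elim (0≢0 refl) }

req⋈off : ∀ x → (req x ∷ []) ⋈ (off x ∷ [])
req⋈off x = x , inj₁ (IsSingle-[ req x ] , IsSingle-[ off x ])

⋈-sym : ∀ {m n} {u : Label m} {v : Label n} → u ⋈ v → v ⋈ u
⋈-sym (α , inj₁ (r , o)) = α , inj₂ (o , r)
⋈-sym (α , inj₂ (o , r)) = α , inj₁ (r , o)

req⋈⇒off : ∀ {x y} → (req x ∷ []) ⋈ (y ∷ []) → y ≡ off x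
req⋈⇒off (_ , inj₁ ((zero , refl , _) , (zero , y≡off , _))) = y≡off
req⋈⇒off (_ , inj₂ ((zero , () , _) , _))

¬IsSingle-twoActive : ∀ {n σ} (v : Label n) {i j : Fin n} → i ≢ j
                    → vlookup v i ≢ idle → vlookup v j ≢ idle → ¬ IsSingle σ v
¬IsSingle-twoActive v {i} {j} i≢j vᵢ≢□ vⱼ≢□ (m , _ , rest) with m ≟ i
... | yes refl = vⱼ≢□ (rest j (≢-sym i≢j))
... | no m≢i = vᵢ≢□ (rest i (≢-sym m≢i))

matchLabel-¬IsSingle : ∀ {n σ} {i j : Fin n} {x y} → i ≢ j → x ≢ idle → y ≢ idle
                     → ¬ IsSingle σ (matchLabel i x j y)
matchLabel-¬IsSingle {i = i} {j} {x} {y} i≢j x≢□ y≢□ =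
  ¬IsSingle-twoActive (matchLabel i x j y) i≢j
    (λ vᵢ≡□ → x≢□ (trans (sym lookup-i) vᵢ≡□))
    (λ vⱼ≡□ → y≢□ (trans (sym lookup-j) vⱼ≡□))
  where
  lookup-i : vlookup (matchLabel i x j y) i ≡ x
  lookup-i = trans (lookup∘tabulate _ i)
    (cong (λ b → if b then x else (if does (i ≟ j) then y else idle)) (dec-true (i ≟ i) refl))
  lookup-j : vlookup (matchLabel i x j y) j ≡ y
  lookup-j = trans (lookup∘tabulate _ j)
    (cong₂ (λ b c → if b then x else (if c then y else idle))
           (dec-false (j ≟ i) (≢-sym i≢j)) (dec-true (j ≟ j) refl))

singleLabel-IsSingle⁻ : ∀ {n σ} {i : Fin n} {x}
                      → IsSingle σ (singleLabel i x) → σ ≢ idle → x ≡ σ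
singleLabel-IsSingle⁻ {i = i} {x} (m , vₘ≡σ , _) σ≢□ with m ≟ i | lookup∘tabulate
  (λ k → if does (k ≟ i) then x else idle) m
... | yes refl | vₘ≡x = trans (sym vₘ≡x) vₘ≡σ
... | no _     | vₘ≡□ = ⊥-elim (σ≢□ (trans (sym vₘ≡σ) vₘ≡□))

antecedent : Clause → List Atom
antecedent (conj J) = J
antecedent (imp J b) = J
antecedent (fuse J b) = J

Offers : (c : Clause) → State ⟦ c ⟧c → Atom → Set
Offers (conj J) q x = x ∈ J
Offers (imp J b) q x = q ≡ ∅ × x ≡ b
Offers (fuse J b) q x = x ≡ b

offers? : (c : Clause) (q : State ⟦ c ⟧c) (x : Atom) → Dec (Offers c q x)
offers? (conj J) q x = x ∈? J
offers? (imp J b) q x = ≡-dec Bool._≟_ q ∅ ×-dec (x ℕ.≟ b)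
offers? (fuse J b) q x = x ℕ.≟ b

offers⇒Trans : (c : Clause) {q : State ⟦ c ⟧c} {x : Atom}
             → Offers c q x → Trans ⟦ c ⟧c q (off x ∷ []) q
offers⇒Trans (conj J) x∈J =
  subst (λ y → ConjTrans J tt (off y ∷ []) tt) (sym (lookup-index x∈J)) (offJ (index x∈J))
offers⇒Trans (imp J b) (refl , refl) = offB
offers⇒Trans (fuse J b) {q} refl = offB q

Trans⇒offers : (c : Clause) {q t : State ⟦ c ⟧c} {x : Atom}
             → Trans ⟦ c ⟧c q (off x ∷ []) t → Offers c q x
Trans⇒offers (conj J) (offJ j) = ∈-lookup j
Trans⇒offers (imp J b) offB = refl , refl
Trans⇒offers (fuse J b) (offB q) = refl

request∈antecedent : (c : Clause) {q t : State ⟦ c ⟧c} {x : Atom}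
                   → Trans ⟦ c ⟧c q (req x ∷ []) t → x ∈ antecedent c
request∈antecedent (imp J b) (reqJ j _) = ∈-lookup j
request∈antecedent (fuse J b) (reqJ j _) = ∈-lookup j

∪⁅⁆≢∅ : ∀ {m} (q : Subset m) (j : Fin m) → q ∪ ⁅ j ⁆ ≢ ∅
∪⁅⁆≢∅ q j q∪j≡∅ = ∉⊥ (subst (j ∈ₛ_) q∪j≡∅ (q⊆p∪q q ⁅ j ⁆ (x∈⁅x⁆ j)))

final⇒¬request : (c : Clause) {q t : State ⟦ c ⟧c} {x : Atom}
               → Final ⟦ c ⟧c q → ¬ Trans ⟦ c ⟧c q (req x ∷ []) t
final⇒¬request (imp J b) q≡∅ (reqJ {q'} j _) = ∪⁅⁆≢∅ q' j q≡∅
final⇒¬request (fuse J b) q≡∅ (reqJ {q'} j _) = ∪⁅⁆≢∅ q' j q≡∅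

offers⇒¬request : (c : Clause) → WFClause c → {q t : State ⟦ c ⟧c} {x : Atom}
                → Offers c q x → ¬ Trans ⟦ c ⟧c q (req x ∷ []) t
offers⇒¬request (imp J b) _ (q≡∅ , _) = final⇒¬request (imp J b) q≡∅
offers⇒¬request (fuse J b) (_ , _ , b∉J) refl (reqJ j _) = b∉J (∈-lookup j)

request-preserves-offers : (c : Clause) {q t : State ⟦ c ⟧c} {x y : Atom}
                         → Trans ⟦ c ⟧c q (req x ∷ []) t → Offers c q y → Offers c t y
request-preserves-offers (imp J b) tr (q≡∅ , _) = ⊥-elim (final⇒¬request (imp J b) q≡∅ tr)
request-preserves-offers (fuse J b) tr b≡y = b≡y

offers-conj : ∀ {c J x} → c ≡ conj J → (q : State ⟦ c ⟧c) → x ∈ J → Offers c q x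
offers-conj refl q x∈J = x∈J

offers-imp : ∀ {c J x} → c ≡ imp J x → (q : State ⟦ c ⟧c) → Final ⟦ c ⟧c q → Offers c q x
offers-imp refl q q≡∅ = q≡∅ , refl

offers-fuse : ∀ {c J x} → c ≡ fuse J x → (q : State ⟦ c ⟧c) → Offers c q x
offers-fuse refl q = refl

data Emptying : ∀ {m} → Subset m → Set where
  []     : ∀ {m} → Emptying (∅ {m})
  insert : ∀ {m} {q : Subset m} j → j ∉ₛ q → Emptying q → Emptying (q ∪ ⁅ j ⁆)

Emptying-outside : ∀ {m} {q : Subset m} → Emptying q → Emptying (outside ∷ q)
Emptying-outside [] = []
Emptying-outside (insert j j∉q e) =
  insert (suc j) (λ { (there j∈q) → j∉q j∈q }) (Emptying-outside e)

emptying : ∀ {m} (q : Subset m) → Emptying q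
emptying [] = []
emptying (false ∷ q) = Emptying-outside (emptying q)
emptying (true ∷ q) = subst Emptying (cong (inside ∷_) (∪-identityʳ q))
  (insert zero (λ ()) (Emptying-outside (emptying q)))

data Completion (A : CA 1) : State A → Set where
  done : ∀ {q} → Final A q → Completion A q
  step : ∀ {q x q'} → Trans A q (req x ∷ []) q' → Completion A q' → Completion A q

Emptying⇒Completion :
  ∀ J {T : Subset (length J) → Label 1 → Subset (length J) → Set}
  → (∀ {q} j → j ∉ₛ q → T (q ∪ ⁅ j ⁆) (req (lookup J j) ∷ []) q)
  → ∀ {q} → Emptying q
  → Completion (record { State = Subset (length J) ; init = full ; Final = _≡ ∅ ; Trans = T }) q
Emptying⇒Completion J requestJ [] = done refl
Emptying⇒Completion J requestJ (insert j j∉q e) =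
  step (requestJ j j∉q) (Emptying⇒Completion J requestJ e)

completion : (c : Clause) (q : State ⟦ c ⟧c) → Completion ⟦ c ⟧c q
completion (conj J) q = done tt
completion (imp J b) q = Emptying⇒Completion J reqJ (emptying q)
completion (fuse J b) q = Emptying⇒Completion J reqJ (emptying q)

-- The least model of the Horn clauses

module _ {n : ℕ} (cl : Fin n → Clause) where

  data Derivable : Atom → Set where
    byConj : ∀ {x} k {J} → cl k ≡ conj J → x ∈ J → Derivable x
    byImp  : ∀ {x} k {J} → cl k ≡ imp J x → All Derivable J → Derivable x
    byFuse : ∀ {x} k {J} → cl k ≡ fuse J x → Derivable x

  open Semantics Derivable

  Derivable-satisfies : ∀ k → ⟪ clauseF (cl k) ⟫
  Derivable-satisfies k with cl k in eq
  ... | conj J = ⋀-intro (map⁺ (All.tabulate (byConj k eq)))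
  ... | imp J b = λ J-holds → byImp k eq (map⁻ (⋀-elim (map atom J) J-holds))
  ... | fuse J b = byFuse k eq

Derivable-satisfies-toFormula : (p : List Clause)
                              → Semantics.⟪ Derivable (lookup p) ⟫ (toFormula p)
Derivable-satisfies-toFormula p =
  ⋀-intro (map⁺ (subst (All _) (tabulate-lookup p) (tabulate⁺ (Derivable-satisfies (lookup p)))))
  where open Semantics (Derivable (lookup p))

module Run {n : ℕ} (cl : Fin n → Clause) (wf : ∀ k → WFClause (cl k)) (a : Atom) where

  A : Fin n → CA 1
  A k = ⟦ cl k ⟧c

  Config : Set
  Config = PState A

  _[_≔_] : Config → (i : Fin n) → State (A i) → Config
  (s [ i ≔ t ]) k with i ≟ k
  ... | yes refl = t
  ... | no _ = s k

  ≔-≡ : ∀ s i t → (s [ i ≔ t ]) i ≡ t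
  ≔-≡ s i t with i ≟ i
  ... | yes refl = refl
  ... | no i≢i = ⊥-elim (i≢i refl)

  ≔-≢ : ∀ {s i t k} → k ≢ i → (s [ i ≔ t ]) k ≡ s k
  ≔-≢ {i = i} {k = k} k≢i with i ≟ k
  ... | yes refl = ⊥-elim (k≢i refl)
  ... | no _ = refl

  Offered : Config → Atom → Set
  Offered s x = ∃ λ k → Offers (cl k) (s k) x

  jointMove : ∀ {s s'} i k {x y} → k ≢ i → x ≢ idle → y ≢ idle
            → Trans (A i) (s i) (x ∷ []) (s' i) → Trans (A k) (s k) (y ∷ []) (s' k)
            → (x ∷ []) ⋈ (y ∷ []) → (∀ k' → k' ≢ i → k' ≢ k → s' k' ≡ s k')
            → ∃ λ l → PTrans A s l s' × (∀ σ → ¬ IsSingle σ l)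
  jointMove i k k≢i x≢□ y≢□ tᵢ tₖ x⋈y rest with <-cmp i k
  ... | tri< i<k _ _ =
    _ , match i k _ _ i<k tᵢ tₖ x⋈y rest , λ _ → matchLabel-¬IsSingle (≢-sym k≢i) x≢□ y≢□
  ... | tri≈ _ i≡k _ = ⊥-elim (k≢i (sym i≡k))
  ... | tri> _ _ k<i =
    _ , match k i _ _ k<i tₖ tᵢ (⋈-sym {u = _ ∷ []} {v = _ ∷ []} x⋈y)
              (λ k' k'≢k k'≢i → rest k' k'≢i k'≢k)
      , λ _ → matchLabel-¬IsSingle k≢i y≢□ x≢□

  matchedRequest : ∀ {s i x t} k → k ≢ i
                 → Trans (A i) (s i) (req x ∷ []) t → Offers (cl k) (s k) x
                 → ∃ λ l → PTrans A s l (s [ i ≔ t ]) × ¬ IsRequestOn a l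
  matchedRequest {s} {i} {x} {t} k k≢i tr x∈offers =
    let l , move , ¬single = jointMove i k k≢i (λ ()) (λ ())
          (subst (Trans (A i) (s i) (req x ∷ [])) (sym (≔-≡ s i t)) tr)
          (subst (Trans (A k) (s k) (off x ∷ [])) (sym (≔-≢ k≢i)) (offers⇒Trans (cl k) x∈offers))
          (req⋈off x) (λ k' k'≢i _ → ≔-≢ k'≢i)
    in l , move , ¬single (req a)

  unmatchedRequest : ∀ {s i x t} → Trans (A i) (s i) (req x ∷ []) t → (x ≡ a → Offered s a)
                   → ¬ (∃ λ k → k ≢ i × Offers (cl k) (s k) x)
                   → ∃ λ l → PTrans A s l (s [ i ≔ t ]) × ¬ IsRequestOn a l
  unmatchedRequest {s} {i} {x} {t} tr a-offered unmatched =
    singleLabel i (req x)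
    , single i (req x) (subst (Trans (A i) (s i) (req x ∷ [])) (sym (≔-≡ s i t)) tr)
             (λ k → ≔-≢) noPartner
    , bareRequest
    where
    noPartner : ∀ j → j ≢ i → ∀ y t' → Trans (A j) (s j) (y ∷ []) t'
              → ¬ ((req x ∷ []) ⋈ (y ∷ []))
    noPartner j j≢i y t' tr' x⋈y = unmatched (j , j≢i , Trans⇒offers (cl j)
      (subst (λ z → Trans (A j) (s j) (z ∷ []) t') (req⋈⇒off x⋈y) tr'))
    bareRequest : ¬ IsRequestOn a (singleLabel i (req x))
    bareRequest request-a with singleLabel-IsSingle⁻ request-a (λ ())
    ... | refl with a-offered refl
    ...   | k , a∈offers with k ≟ i
    ...     | yes refl = offers⇒¬request (cl i) (wf i) a∈offers tr
    ...     | no k≢i = unmatched (k , k≢i , a∈offers)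

  request : ∀ {s i x t} → Trans (A i) (s i) (req x ∷ []) t → (x ≡ a → Offered s a)
          → ∃ λ l → PTrans A s l (s [ i ≔ t ]) × ¬ IsRequestOn a l
  request {s} {i} {x} tr a-offered with any? (λ k → ¬? (k ≟ i) ×-dec offers? (cl k) (s k) x)
  ... | yes (k , k≢i , x∈offers) = matchedRequest k k≢i tr x∈offers
  ... | no unmatched = unmatchedRequest tr a-offered unmatched

  record _↝_ (s s' : Config) : Set where
    field
      word     : List (Label n)
      run      : Path (⊠ A) s word s'
      clean    : All (λ l → ¬ IsRequestOn a l) word
      offered⁺ : ∀ {x} → Offered s x → Offered s' x
      final⁺   : ∀ k → Final (A k) (s k) → Final (A k) (s' k)
  open _↝_

  ↝-refl : ∀ {s} → s ↝ s
  ↝-refl = record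
    { word = [] ; run = [] ; clean = [] ; offered⁺ = λ o → o ; final⁺ = λ _ f → f }

  ↝-trans : ∀ {s s' s''} → s ↝ s' → s' ↝ s'' → s ↝ s''
  ↝-trans g h = record
    { word = word g ++ word h ; run = run g ++ᴾ run h ; clean = ++⁺ (clean g) (clean h)
    ; offered⁺ = offered⁺ h ∘ offered⁺ g ; final⁺ = λ k → final⁺ h k ∘ final⁺ g k }

  ↝-request : ∀ {s i x t} → Trans (A i) (s i) (req x ∷ []) t → (x ≡ a → Offered s a)
            → s ↝ (s [ i ≔ t ])
  ↝-request {s} {i} {x} {t} tr a-offered =
    let l , move , ¬request-a = request tr a-offered
    in record { word = l ∷ [] ; run = move ∷ [] ; clean = ¬request-a ∷ []
              ; offered⁺ = offered ; final⁺ = final }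
    where
    offered : ∀ {y} → Offered s y → Offered (s [ i ≔ t ]) y
    offered {y} (k , y∈offers) with k ≟ i
    ... | yes refl = k , subst (λ q → Offers (cl k) q y) (sym (≔-≡ s k t))
                               (request-preserves-offers (cl k) tr y∈offers)
    ... | no k≢i = k , subst (λ q → Offers (cl k) q y) (sym (≔-≢ k≢i)) y∈offers
    final : ∀ k → Final (A k) (s k) → Final (A k) ((s [ i ≔ t ]) k)
    final k f with k ≟ i
    ... | yes refl = ⊥-elim (final⇒¬request (cl k) f tr)
    ... | no k≢i = subst (Final (A k)) (sym (≔-≢ k≢i)) f

  complete : ∀ {s i q} → s i ≡ q → Completion (A i) q
           → (a ∈ antecedent (cl i) → Offered s a)
           → ∃ λ s' → s ↝ s' × Final (A i) (s' i)
  complete refl (done f) _ = _ , ↝-refl , f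
  complete {s} {i} refl (step tr c) a-offered =
    let s↝ = ↝-request tr λ x≡a →
               a-offered (subst (_∈ antecedent (cl i)) x≡a (request∈antecedent (cl i) tr))
        s' , ↝s' , f = complete (≔-≡ s i _) c (offered⁺ s↝ ∘ a-offered)
    in s' , ↝-trans s↝ ↝s' , f

  reach : ∀ {x} → Derivable cl x → ∀ s → ∃ λ s' → s ↝ s' × Offered s' x
  reachAll : ∀ {J} → All (Derivable cl) J → ∀ s → ∃ λ s' → s ↝ s' × All (Offered s') J
  reach (byConj k eq x∈J) s = s , ↝-refl , k , offers-conj eq (s k) x∈J
  reach (byFuse k eq) s = s , ↝-refl , k , offers-fuse eq (s k)
  reach (byImp k eq J-derivable) s =
    let s₁ , s↝s₁ , J-offered = reachAll J-derivable s
        s₂ , s₁↝s₂ , final = complete refl (completion (cl k) (s₁ k))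
          (λ a∈J → All.lookup J-offered (subst (a ∈_) (cong antecedent eq) a∈J))
    in s₂ , ↝-trans s↝s₁ s₁↝s₂ , k , offers-imp eq (s₂ k) final
  reachAll [] s = s , ↝-refl , []
  reachAll (d ∷ ds) s =
    let s₁ , s↝s₁ , x-offered = reach d s
        s₂ , s₁↝s₂ , J-offered = reachAll ds s₁
    in s₂ , ↝-trans s↝s₁ s₁↝s₂ , offered⁺ s₁↝s₂ x-offered ∷ J-offered

  completeAll : (ks : List (Fin n)) → ∀ s → Offered s a
              → ∃ λ s' → s ↝ s' × All (λ k → Final (A k) (s' k)) ks
  completeAll [] s _ = s , ↝-refl , []
  completeAll (k ∷ ks) s a-offered =
    let s₁ , s↝s₁ , f = complete refl (completion (cl k) (s k)) (λ _ → a-offered)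
        s₂ , s₁↝s₂ , fs = completeAll ks s₁ (offered⁺ s↝s₁ a-offered)
    in s₂ , ↝-trans s↝s₁ s₁↝s₂ , final⁺ s₁↝s₂ k f ∷ fs

  acceptedWithoutRequestOn : Derivable cl a
                           → ∃ λ w → w ∈𝓛 ⊠ A × All (λ l → ¬ IsRequestOn a l) w
  acceptedWithoutRequestOn a-derivable =
    let s₁ , init↝s₁ , a-offered = reach a-derivable (λ k → init (A k))
        s₂ , s₁↝s₂ , finals = completeAll (allFin n) s₁ a-offered
        init↝s₂ = ↝-trans init↝s₁ s₁↝s₂
    in word init↝s₂
       , (s₂ , run init↝s₂ , λ k → All.lookup finals (∈-allFin k))
       , clean init↝s₂

lemma9p4 : (p : List Clause) → HPCL p → (a : Atom) → a ∈ atoms p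
         → (toFormula p ∷ []) ⊢ atom a
         → Σ (List (Label _)) λ w → w ∈𝓛 ⟦ p ⟧ × All (λ l → ¬ IsRequestOn a l) w
lemma9p4 p (_ , wf) a _ ⊢a =
  acceptedWithoutRequestOn (sound ⊢a (Derivable-satisfies-toFormula p ∷ []))
  where
  open Semantics (Derivable (lookup p))
  open Run (lookup p) (λ k → All.lookup wf (∈-lookup k)) a
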